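{- Let $\mathcal{T}$ be a tanglegram having exactly one cross-responsible set $X$, with $\mathcal{T}[X]$ isomorphic to $\mathcal{K}_2$, and label the edges of $\mathcal{T}[X]$ by the standardized labeling of $\mathcal{K}_2$. Then: (i) for every $m\in\sigma_{\mathcal{T}}\setminus X$, the scar-type of $m$ in $\mathcal{T}[X]$ is one of $(a_1,a_2)$, $(a_1,b_2)$, $(b_1,a_2)$, $(a_1,c_2)$, $(c_1,a_2)$, $(b_1,c_2)$, $(c_1,b_2)$, $(d_1,f_2)$, $(f_1,d_2)$; (ii) the edges $e_1,e_2,g_1,g_2$ carry no scars in $\mathcal{T}[X]$; (iii) for $j\in\{1,2\}$, an edge $m\in\sigma_{\mathcal{T}}\setminus X$ has a scar on $d_j$ in $\mathcal{T}[X]$ if and only if it has a scar on $f_{3-j}$.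
   Context: A rooted tree is a tree with at least two vertices and a designated root of degree $1$; leaves are non-root vertices of degree $1$; a rooted binary tree is a rooted tree in which all non-root, non-leaf vertices have degree $3$. For a set $S$ of leaves of a rooted binary tree $T$, $T\llbracket S\rrbracket$ is the union of the root-to-$s$ paths for $s\in S$, and $T[S]$ is obtained from $T\llbracket S\rrbracket$ by suppressing degree-$2$ vertices; each edge $e$ of $T[S]$ corresponds to a path $P_e$ of $T\llbracket S\rrbracket$. For a leaf $w\notin S$, the scar of $w$ in $T[S]$ is on edge $e$ if the first vertex of $T\llbracket S\rrbracket$ met by the path from $w$ to the root is an interior vertex of $P_e$; an edge of $T[S]$ carries a scar if some leaf outside $S$ has its scar on it. A tanglegram $\mathcal{T}=(L_{\mathcal{T}},R_{\mathcal{T}},\sigma_{\mathcal{T}})$ consists of two rooted binary trees with equally many leaves and a perfect matching $\sigma_{\mathcal{T}}$ between their leaf sets. For $Z\subseteq\sigma_{\mathcal{T}}$, $\mathcal{T}[Z]$ has left tree $L_{\mathcal{T}}[S_1]$, right tree $R_{\mathcal{T}}[S_2]$ and matching $Z$, where $S_1,S_2$ are the left and right leaves covered by $Z$. Tanglegrams are isomorphic if there is a graph isomorphism mapping left root to left root and right root to right root. For $m\in\sigma_{\mathcal{T}}\setminus Z$ with left endpoint $\mu_1$ and right endpoint $\mu_2$, its left-scar in $\mathcal{T}[Z]$ is the scar of $\mu_1$ in $L_{\mathcal{T}}[S_1]$, its right-scar is the scar of $\mu_2$ in $R_{\mathcal{T}}[S_2]$, and its scar-type is the ordered pair $(e,f)$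 with the left-scar on edge $e$ and the right-scar on edge $f$. An edge $m$ "has a scar on" an edge of $\mathcal{T}[Z]$ if its left-scar or right-scar lies on it. $\mathcal{K}_1$ is the size-$4$ tanglegram in which each tree has root adjacent to an internal vertex whose two children each have two leaf children, with left cherries $\{l_1,l_2\},\{l_3,l_4\}$, right cherries $\{r_1,r_2\},\{r_3,r_4\}$ and matching $l_1r_1, l_2r_3, l_3r_2, l_4r_4$. $\mathcal{K}_2$ is the size-$4$ tanglegram whose left tree has root $\rho_L$ adjacent to $v_1$, $v_1$ has children leaf $l_1$ and $v_2$, $v_2$ has children leaf $l_2$ and $v_3$, $v_3$ has leaf children $l_3,l_4$; whose right tree has root $\rho_R$ adjacent to $w_1$, $w_1$ has children leaf $r_1$ and $w_2$, $w_2$ has children leaf $r_2$ and $w_3$, $w_3$ has leaf children $r_3,r_4$; and whose matching is $u_2=l_1r_4$, $x=l_2r_2$, $y=l_3r_3$, $u_1=l_4r_1$. A set $Y\subseteq\sigma_{\mathcal{T}}$ is cross-responsible if $\mathcal{T}[Y]$ is isomorphic to $\mathcal{K}_1$ or $\mathcal{K}_2$. Standardized labeling of $\mathcal{K}_2$ (the isomorphism $\mathcal{T}[X]\cong\mathcal{K}_2$ is unique, so the labels transfer to $\mathcal{T}[X]$): left tree edges $a_1=\rho_Lv_1$, $c_1=v_1l_1$, $b_1=v_1v_2$, $d_1=v_2l_2$, $e_1=v_2v_3$, $f_1=v_3l_3$, $g_1=v_3l_4$; right tree edges $a_2=\rho_Rw_1$, $c_2=w_1r_1$, $b_2=w_1w_2$,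 $d_2=w_2r_2$, $e_2=w_2w_3$, $f_2=w_3r_3$, $g_2=w_3r_4$. -}

module Defs where

open import Data.Nat using (ℕ)
import Data.Fin as Fin
open Fin using (Fin)
open import Data.Fin.Subset using (Subset; ⁅_⁆; _∪_; _∩_; _∈_; _∉_; Nonempty)
open import Data.Fin.Subset.Properties using (_∈?_; nonempty?)
open import Data.List using (List; []; _∷_; _++_)
open import Data.List.Membership.Propositional using () renaming (_∈_ to _∈ₗ_)
open import Data.List.Relation.Unary.Unique.Propositional using (Unique)
open import Data.Maybe using (Maybe; just; nothing)
open import Data.Product using (Σ; _×_; _,_)
open import Data.Sum using (_⊎_)
open import Data.Vec using (lookup)
open import Data.Bool using (true; false)
open import Relation.Nullary using (yes; no)
open import Relation.Binary.PropositionalEquality using (_≡_)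

-- A value of 'Tree A' is the part of a rooted binary tree below the
-- (implicit, degree-1) root ρ: 'leaf a' is a leaf labelled a, and
-- 'node l r' is a degree-3 vertex with the two subtrees l, r as children.
-- The children are unordered; this is accounted for by '_≅_' below.
-- Every non-root vertex (= every subtree occurrence) has exactly one edge
-- to its parent (the top vertex's parent being ρ), so edges of the tree
-- correspond to subtree occurrences.

data Tree (A : Set) : Set where
  leaf : A → Tree A
  node : Tree A → Tree A → Tree A

leaves : {A : Set} → Tree A → List A
leaves (leaf a)   = a ∷ []
leaves (node l r) = leaves l ++ leaves r

mapT : {A B : Set} → (A → B) → Tree A → Tree B
mapT f (leaf a)   = leaf (f a)
mapT f (node l r) = node (mapT f l) (mapT f r)

data _≅_ {A : Set} : Tree A → Tree A → Set where
  leaf≅ : ∀ a → leaf a ≅ leaf a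
  node≅ : ∀ {l r l′ r′} → l ≅ l′ → r ≅ r′ → node l r ≅ node l′ r′
  swap≅ : ∀ {l r l′ r′} → l ≅ r′ → r ≅ l′ → node l r ≅ node l′ r′

-- Positions (= edges: the edge above the vertex at that position).
data Pos {A : Set} : Tree A → Set where
  here : ∀ {t} → Pos t
  inl  : ∀ {l r} → Pos l → Pos (node l r)
  inr  : ∀ {l r} → Pos r → Pos (node l r)

subtreeAt : {A : Set} (t : Tree A) → Pos t → Tree A
subtreeAt t here = t
subtreeAt (node l r) (inl p) = subtreeAt l p
subtreeAt (node l r) (inr p) = subtreeAt r p

-- The matching edges are identified with Fin n:
-- matching edge i joins the left leaf labelled i with the right leaf
-- labelled i.

record Tanglegram (n : ℕ) : Set where
  field
    L R      : Tree (Fin n)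
    L-unique : Unique (leaves L)
    R-unique : Unique (leaves R)
    L-all    : ∀ i → i ∈ₗ leaves L
    R-all    : ∀ i → i ∈ₗ leaves R
open Tanglegram public

leafSet : {n : ℕ} → Tree (Fin n) → Subset n
leafSet (leaf a)   = ⁅ a ⁆
leafSet (node l r) = leafSet l ∪ leafSet r

restrict : {n : ℕ} → Subset n → Tree (Fin n) → Maybe (Tree (Fin n))
restrict S (leaf a) with lookup S a
... | true  = just (leaf a)
... | false = nothing
restrict S (node l r) with restrict S l | restrict S r
... | just l′  | just r′  = just (node l′ r′)
... | just l′  | nothing  = just l′
... | nothing  | just r′  = just r′
... | nothing  | nothing  = nothing

-- The edges of T[S] are identified by the set of
-- (S-)leaves of T[S] below them (distinct edges of a rooted binary tree
-- have distinct leaf sets).  Walking up from w, the first vertex u of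
-- T⟦S⟧ is the lowest strict ancestor of w having a leaf of S below it;
-- u is an interior vertex of the path P_e of the edge e of T[S] whose
-- leaf set is S ∩ leafSet(u).  'scar S t w' returns that leaf set
-- (nothing if w is not a leaf of t or no ancestor of w meets S).
scar : {n : ℕ} → Subset n → Tree (Fin n) → Fin n → Maybe (Subset n)
scar S (leaf a) w = nothing
scar S (node l r) w with w ∈? leafSet l
scar S (node l r) w | yes _ with scar S l w
... | just c  = just c
... | nothing with nonempty? (S ∩ leafSet r)
...   | yes _ = just (S ∩ leafSet (node l r))
...   | no  _ = nothing
scar S (node l r) w | no _ with w ∈? leafSet r
scar S (node l r) w | no _ | yes _ with scar S r w
... | just c  = just c
... | nothing with nonempty? (S ∩ leafSet l)
...   | yes _ = just (S ∩ leafSet (node l r))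
...   | no  _ = nothing
scar S (node l r) w | no _ | no _ = nothing

data Side : Set where
  left right : Side

Edge : ℕ → Set
Edge n = Side × Subset n

treeOf : {n : ℕ} → Tanglegram n → Side → Tree (Fin n)
treeOf T left  = L T
treeOf T right = R T

scarOf : {n : ℕ} → Tanglegram n → Subset n → Fin n → Side → Maybe (Subset n)
scarOf T Z m s = scar Z (treeOf T s) m

HasScarOn : {n : ℕ} → Tanglegram n → Subset n → Fin n → Edge n → Set
HasScarOn T Z m (s , C) = scarOf T Z m s ≡ just C

CarriesScar : {n : ℕ} → Tanglegram n → Subset n → Edge n → Set
CarriesScar {n} T Z e = Σ (Fin n) λ m → m ∉ Z × HasScarOn T Z m e

-- K2: matching edges u2 = l1r4, x = l2r2, y = l3r3, u1 = l4r1.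
u2 x y u1 : Fin 4
u2 = Fin.zero
x  = Fin.suc Fin.zero
y  = Fin.suc (Fin.suc Fin.zero)
u1 = Fin.suc (Fin.suc (Fin.suc Fin.zero))

-- K1: matching edges (reusing the names of Fin 4 elements)
-- u2 = l1r1, x = l2r3, y = l3r2, u1 = l4r4.
K1L K1R : Tree (Fin 4)
K1L = node (node (leaf u2) (leaf x)) (node (leaf y) (leaf u1))
K1R = node (node (leaf u2) (leaf y)) (node (leaf x) (leaf u1))

K2L K2R : Tree (Fin 4)
K2L = node (leaf u2) (node (leaf x) (node (leaf y) (leaf u1)))
K2R = node (leaf u1) (node (leaf x) (node (leaf y) (leaf u2)))

-- T[Z] is isomorphic to the tanglegram (KL, KR) via φ, where φ sends a
-- matching edge of K to the corresponding matching edge of T.  (Since the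
-- leaf labels of T[Z] are distinct, φ is then a bijection onto Z, and the
-- matchings correspond since the same φ is used on both sides.)
IsoVia : {n : ℕ} → Tanglegram n → Subset n → (Fin 4 → Fin n) →
         Tree (Fin 4) → Tree (Fin 4) → Set
IsoVia {n} T Z φ KL KR =
  (Σ (Tree (Fin n)) λ t → restrict Z (L T) ≡ just t × mapT φ KL ≅ t) ×
  (Σ (Tree (Fin n)) λ t → restrict Z (R T) ≡ just t × mapT φ KR ≅ t)

IsoTo : {n : ℕ} → Tanglegram n → Subset n → Tree (Fin 4) → Tree (Fin 4) → Set
IsoTo {n} T Z KL KR = Σ (Fin 4 → Fin n) λ φ → IsoVia T Z φ KL KR

CrossResponsible : {n : ℕ} → Tanglegram n → Subset n → Set
CrossResponsible T Y = IsoTo T Y K1L K1R ⊎ IsoTo T Y K2L K2R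

-- Standardized labelling of K2, transferred to T[X] along φ: the edge of
-- T[X] corresponding to the edge of K2 above position p has leaf set
-- φ(leaves of K2 below p).

K2side : Side → Tree (Fin 4)
K2side left  = K2L
K2side right = K2R

K2edge : {n : ℕ} → (Fin 4 → Fin n) → (s : Side) → Pos (K2side s) → Edge n
K2edge φ s p = s , leafSet (mapT φ (subtreeAt (K2side s) p))

module Labels {n : ℕ} (φ : Fin 4 → Fin n) where
  a₁ b₁ c₁ d₁ e₁ f₁ g₁ a₂ b₂ c₂ d₂ e₂ f₂ g₂ : Edge n
  a₁ = K2edge φ left here
  c₁ = K2edge φ left (inl here)
  b₁ = K2edge φ left (inr here)
  d₁ = K2edge φ left (inr (inl here))
  e₁ = K2edge φ left (inr (inr here))
  f₁ = K2edge φ left (inr (inr (inl here)))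
  g₁ = K2edge φ left (inr (inr (inr here)))
  a₂ = K2edge φ right here
  c₂ = K2edge φ right (inl here)
  b₂ = K2edge φ right (inr here)
  d₂ = K2edge φ right (inr (inl here))
  e₂ = K2edge φ right (inr (inr here))
  f₂ = K2edge φ right (inr (inr (inl here)))
  g₂ = K2edge φ right (inr (inr (inr here)))

ScarType : {n : ℕ} → Tanglegram n → Subset n → Fin n → Edge n → Edge n → Set
ScarType T Z m e f = HasScarOn T Z m e × HasScarOn T Z m f

{-# OPTIONS --safe #-}
-- For m ∉ X, restricting either tree of T to X ∪ {m} gives the corresponding tree of T[X] ≅ K2 with
-- m grafted onto the edge that carries the scar of m.  So the scar-type of m is a pair (p , q) of
-- edges of K2, and T[X ∪ {m}] is K2 with a fifth leaf grafted onto p and q.  For each of the 40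
-- pairs not listed in (i), some four leaves of this 5-leaf tanglegram, the new one among them,
-- induce K1 or K2 (found by exhaustive search); their preimage in T is then a cross-responsible set
-- containing m, contradicting the uniqueness of X.  Parts (ii) and (iii) are read off the list,
-- since distinct edges of T[X] have distinct leaf sets.
module Submission where

open import Defs
open import Data.Nat using (ℕ)
open import Data.Fin using (Fin)
open import Data.Fin.Subset using (Subset; _∉_)
open import Data.Product using (_×_)
open import Data.Sum using (_⊎_)
open import Relation.Nullary using (¬_)
open import Relation.Binary.PropositionalEquality using (_≡_)
open import Function.Bundles using (_⇔_)

import Data.Nat as ℕ
open import Data.Bool using (true; false)
open import Data.Empty using (⊥; ⊥-elim)
open import Data.Fin using (zero; suc; _≟_)
open import Data.Fin.Subset using (⁅_⁆; _∪_; _∩_; _∈_; _⊆_; Nonempty; Empty) renaming (⊥ to ∅)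
open import Data.Fin.Subset.Properties
  using (_∈?_; nonempty?; ∈⊤; ∉⊥; x∈⁅x⁆; x∈⁅y⁆⇒x≡y; x∈p∪q⁺; x∈p∪q⁻; x∈p∩q⁺; x∈p∩q⁻;
         p∩q⊆p; p∩q⊆q; ⊆-antisym; ∪-comm; ∪-identityˡ; ∪-identityʳ; ∩-distribˡ-∪)
open import Data.List as List using (List; []; _∷_; _++_; concatMap; allFin)
open import Data.List.Membership.Propositional using () renaming (_∈_ to _∈ₗ_)
open import Data.List.Membership.Propositional.Properties using (∈-++⁺ˡ; ∈-++⁺ʳ; ∈-++⁻)
import Data.List.Relation.Unary.All as All
open import Data.List.Relation.Unary.All.Properties using (++⁻ˡ; ++⁻ʳ)
open import Data.List.Relation.Unary.AllPairs using ([]; _∷_)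
open import Data.List.Relation.Unary.Any using (here; there)
open import Data.List.Relation.Unary.Unique.Propositional using (Unique)
open import Data.Maybe as Maybe using (Maybe; just; nothing; _<∣>_; _>>=_; when; from-just)
open import Data.Maybe.Properties using (<∣>-identityʳ; just-injective)
open import Data.Maybe.Relation.Binary.Pointwise as Pointwise using (Pointwise; just; nothing; just-inv)
open import Data.Product as Product using (Σ; ∃-syntax; _,_; proj₁; proj₂)
open import Data.Sum as Sum using (inj₁; inj₂; [_,_]; [_,_]′)
open import Data.Vec using (lookup)
open import Data.Vec.Properties using ([]=⇒lookup; lookup⇒[]=)
open import Data.Vec.Functional using () renaming (_∷_ to _∷ᶠ_)
open import Function using (_∘_; id)
open import Function.Bundles using (Equivalence; mk⇔)
open import Relation.Nullary using (yes; no; does; contradiction)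
open import Relation.Nullary.Decidable using (toSum; dec⇒maybe)
open import Relation.Binary.PropositionalEquality
  using (refl; sym; trans; cong; cong₂; subst; _≢_; module ≡-Reasoning)

private variable
  A B C : Set
  k n : ℕ
  a b m : A
  S X Y : Subset n
  l r s t u t′ : Tree A

≅-refl : (t : Tree A) → t ≅ t
≅-refl (leaf a)   = leaf≅ a
≅-refl (node l r) = node≅ (≅-refl l) (≅-refl r)

≅-reflexive : s ≡ t → s ≅ t
≅-reflexive {t = t} refl = ≅-refl t

≅-sym : s ≅ t → t ≅ s
≅-sym (leaf≅ a)   = leaf≅ a
≅-sym (node≅ p q) = node≅ (≅-sym p) (≅-sym q)
≅-sym (swap≅ p q) = swap≅ (≅-sym q) (≅-sym p)

≅-trans : s ≅ t → t ≅ u → s ≅ u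
≅-trans (leaf≅ a)   (leaf≅ .a)  = leaf≅ a
≅-trans (node≅ p q) (node≅ u v) = node≅ (≅-trans p u) (≅-trans q v)
≅-trans (node≅ p q) (swap≅ u v) = swap≅ (≅-trans p u) (≅-trans q v)
≅-trans (swap≅ p q) (node≅ u v) = swap≅ (≅-trans p v) (≅-trans q u)
≅-trans (swap≅ p q) (swap≅ u v) = node≅ (≅-trans p v) (≅-trans q u)

mapT-≅ : (f : A → B) → s ≅ t → mapT f s ≅ mapT f t
mapT-≅ f (leaf≅ a)   = leaf≅ (f a)
mapT-≅ f (node≅ p q) = node≅ (mapT-≅ f p) (mapT-≅ f q)
mapT-≅ f (swap≅ p q) = swap≅ (mapT-≅ f p) (mapT-≅ f q)

mapT-∘ : (g : B → C) (f : A → B) (t : Tree A) → mapT (g ∘ f) t ≡ mapT g (mapT f t)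
mapT-∘ g f (leaf a)   = refl
mapT-∘ g f (node l r) = cong₂ node (mapT-∘ g f l) (mapT-∘ g f r)

leafSet-≅ : {s t : Tree (Fin n)} → s ≅ t → leafSet s ≡ leafSet t
leafSet-≅ (leaf≅ a)   = refl
leafSet-≅ (node≅ p q) = cong₂ _∪_ (leafSet-≅ p) (leafSet-≅ q)
leafSet-≅ (swap≅ {l′ = l′} {r′} p q) =
  trans (cong₂ _∪_ (leafSet-≅ p) (leafSet-≅ q)) (∪-comm (leafSet r′) (leafSet l′))

leafSet-nonempty : (t : Tree (Fin n)) → Nonempty (leafSet t)
leafSet-nonempty (leaf a)   = a , x∈⁅x⁆ a
leafSet-nonempty (node l r) = let a , a∈l = leafSet-nonempty l in a , x∈p∪q⁺ (inj₁ a∈l)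

∈-leafSet-mapT : (f : Fin k → Fin n) (t : Tree (Fin k)) → a ∈ leafSet t → f a ∈ leafSet (mapT f t)
∈-leafSet-mapT f (leaf b) a∈t rewrite x∈⁅y⁆⇒x≡y b a∈t = x∈⁅x⁆ (f b)
∈-leafSet-mapT f (node l r) a∈t with x∈p∪q⁻ (leafSet l) (leafSet r) a∈t
... | inj₁ a∈l = x∈p∪q⁺ (inj₁ (∈-leafSet-mapT f l a∈l))
... | inj₂ a∈r = x∈p∪q⁺ (inj₂ (∈-leafSet-mapT f r a∈r))

∉-leafSet-node : (l r : Tree (Fin n)) → a ∉ leafSet l → a ∉ leafSet r → a ∉ leafSet (node l r)
∉-leafSet-node l r a∉l a∉r = [ a∉l , a∉r ] ∘ x∈p∪q⁻ (leafSet l) (leafSet r)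

∈-leafSet⇒∈-leaves : (t : Tree (Fin n)) → a ∈ leafSet t → a ∈ₗ leaves t
∈-leafSet⇒∈-leaves (leaf b) a∈t = here (x∈⁅y⁆⇒x≡y b a∈t)
∈-leafSet⇒∈-leaves (node l r) a∈t with x∈p∪q⁻ (leafSet l) (leafSet r) a∈t
... | inj₁ a∈l = ∈-++⁺ˡ (∈-leafSet⇒∈-leaves l a∈l)
... | inj₂ a∈r = ∈-++⁺ʳ (leaves l) (∈-leafSet⇒∈-leaves r a∈r)

∈-leaves⇒∈-leafSet : (t : Tree (Fin n)) → a ∈ₗ leaves t → a ∈ leafSet t
∈-leaves⇒∈-leafSet (leaf b) (here refl) = x∈⁅x⁆ b
∈-leaves⇒∈-leafSet (node l r) a∈t with ∈-++⁻ (leaves l) a∈t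
... | inj₁ a∈l = x∈p∪q⁺ (inj₁ (∈-leaves⇒∈-leafSet l a∈l))
... | inj₂ a∈r = x∈p∪q⁺ (inj₂ (∈-leaves⇒∈-leafSet r a∈r))

data Distinct {n : ℕ} : Tree (Fin n) → Set where
  leaf : Distinct (leaf a)
  node : Distinct l → Distinct r → (∀ {a} → a ∈ leafSet l → a ∉ leafSet r) →
         Distinct (node l r)

Unique-++⁻ : (xs : List A) {ys : List A} → Unique (xs ++ ys) →
             Unique xs × Unique ys × (∀ {a} → a ∈ₗ xs → ¬ a ∈ₗ ys)
Unique-++⁻ []       u        = [] , u , λ ()
Unique-++⁻ (x ∷ xs) (x∉ ∷ u) =
  let uxs , uys , disj = Unique-++⁻ xs u in
  (++⁻ˡ xs x∉ ∷ uxs) , uys ,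
  λ { (here refl) a∈ys → All.lookup (++⁻ʳ xs x∉) a∈ys refl ; (there a∈xs) → disj a∈xs }

Unique⇒Distinct : (t : Tree (Fin n)) → Unique (leaves t) → Distinct t
Unique⇒Distinct (leaf a)   _ = leaf
Unique⇒Distinct (node l r) u =
  let ul , ur , disj = Unique-++⁻ (leaves l) u in
  node (Unique⇒Distinct l ul) (Unique⇒Distinct r ur)
       (λ a∈l a∈r → disj (∈-leafSet⇒∈-leaves l a∈l) (∈-leafSet⇒∈-leaves r a∈r))

Distinct-≅ : {s t : Tree (Fin n)} → s ≅ t → Distinct s → Distinct t
Distinct-≅ (leaf≅ a) d = d
Distinct-≅ (node≅ p q) (node dl dr disj) =
  node (Distinct-≅ p dl) (Distinct-≅ q dr)
       (λ {a} a∈l a∈r → disj (subst (a ∈_) (sym (leafSet-≅ p)) a∈l) (subst (a ∈_) (sym (leafSet-≅ q)) a∈r))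
Distinct-≅ (swap≅ p q) (node dl dr disj) =
  node (Distinct-≅ q dr) (Distinct-≅ p dl)
       (λ {a} a∈l a∈r → disj (subst (a ∈_) (sym (leafSet-≅ p)) a∈r) (subst (a ∈_) (sym (leafSet-≅ q)) a∈l))

Distinct⇒≡leaf : {t : Tree (Fin n)} → Distinct t → (∀ {a} → a ∈ leafSet t → a ≡ m) → t ≡ leaf m
Distinct⇒≡leaf {t = leaf a} _ all≡m = cong leaf (all≡m (x∈⁅x⁆ a))
Distinct⇒≡leaf {t = node l r} (node _ _ disj) all≡m =
  let a , a∈l = leafSet-nonempty l ; b , b∈r = leafSet-nonempty r
      a≡b = trans (all≡m (x∈p∪q⁺ (inj₁ a∈l))) (sym (all≡m (x∈p∪q⁺ (inj₂ b∈r))))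
  in contradiction (subst (_∈ leafSet r) (sym a≡b) b∈r) (disj a∈l)

Distinct-mapT-injective : (f : Fin k → Fin n) (t : Tree (Fin k)) → Distinct (mapT f t) →
                          a ∈ leafSet t → b ∈ leafSet t → f a ≡ f b → a ≡ b
Distinct-mapT-injective f (leaf c) _ a∈t b∈t _ = trans (x∈⁅y⁆⇒x≡y c a∈t) (sym (x∈⁅y⁆⇒x≡y c b∈t))
Distinct-mapT-injective f (node l r) (node dl dr disj) a∈t b∈t fa≡fb
  with x∈p∪q⁻ (leafSet l) (leafSet r) a∈t | x∈p∪q⁻ (leafSet l) (leafSet r) b∈t
... | inj₁ a∈l | inj₁ b∈l = Distinct-mapT-injective f l dl a∈l b∈l fa≡fb
... | inj₂ a∈r | inj₂ b∈r = Distinct-mapT-injective f r dr a∈r b∈r fa≡fb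
... | inj₁ a∈l | inj₂ b∈r =
  contradiction (subst (_∈ leafSet (mapT f r)) (sym fa≡fb) (∈-leafSet-mapT f r b∈r))
                (disj (∈-leafSet-mapT f l a∈l))
... | inj₂ a∈r | inj₁ b∈l =
  contradiction (subst (_∈ leafSet (mapT f r)) fa≡fb (∈-leafSet-mapT f r a∈r))
                (disj (∈-leafSet-mapT f l b∈l))

leafSet-subtreeAt-⊆ : (f : Fin k → Fin n) (t : Tree (Fin k)) (p : Pos t) →
                      leafSet (mapT f (subtreeAt t p)) ⊆ leafSet (mapT f t)
leafSet-subtreeAt-⊆ f t          here    = id
leafSet-subtreeAt-⊆ f (node l r) (inl p) = x∈p∪q⁺ ∘ inj₁ ∘ leafSet-subtreeAt-⊆ f l p
leafSet-subtreeAt-⊆ f (node l r) (inr p) = x∈p∪q⁺ ∘ inj₂ ∘ leafSet-subtreeAt-⊆ f r p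

overlap-⊥ : {P Q W : Subset n} → (∀ {a} → a ∈ P → a ∉ Q) → Nonempty W → W ⊆ P → W ⊆ Q → ⊥
overlap-⊥ disj (a , a∈W) W⊆P W⊆Q = disj (W⊆P a∈W) (W⊆Q a∈W)

leafSet-subtreeAt-injective : (f : Fin k → Fin n) (t : Tree (Fin k)) → Distinct (mapT f t) →
  {p q : Pos t} → leafSet (mapT f (subtreeAt t p)) ≡ leafSet (mapT f (subtreeAt t q)) → p ≡ q
leafSet-subtreeAt-injective f t          _               {here}  {here}  _  = refl
leafSet-subtreeAt-injective f (node l r) (node dl _ _)   {inl p} {inl q} eq =
  cong inl (leafSet-subtreeAt-injective f l dl eq)
leafSet-subtreeAt-injective f (node l r) (node _ dr _)   {inr p} {inr q} eq =
  cong inr (leafSet-subtreeAt-injective f r dr eq)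
leafSet-subtreeAt-injective f (node l r) (node _ _ disj) {here}  {inl q} eq = ⊥-elim
  (overlap-⊥ disj (leafSet-nonempty (mapT f r))
    (leafSet-subtreeAt-⊆ f l q ∘ subst (_ ∈_) eq ∘ x∈p∪q⁺ ∘ inj₂) id)
leafSet-subtreeAt-injective f (node l r) (node _ _ disj) {here}  {inr q} eq = ⊥-elim
  (overlap-⊥ disj (leafSet-nonempty (mapT f l))
    id (leafSet-subtreeAt-⊆ f r q ∘ subst (_ ∈_) eq ∘ x∈p∪q⁺ ∘ inj₁))
leafSet-subtreeAt-injective f (node l r) (node _ _ disj) {inl p} {here}  eq = ⊥-elim
  (overlap-⊥ disj (leafSet-nonempty (mapT f r))
    (leafSet-subtreeAt-⊆ f l p ∘ subst (_ ∈_) (sym eq) ∘ x∈p∪q⁺ ∘ inj₂) id)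
leafSet-subtreeAt-injective f (node l r) (node _ _ disj) {inr p} {here}  eq = ⊥-elim
  (overlap-⊥ disj (leafSet-nonempty (mapT f l))
    id (leafSet-subtreeAt-⊆ f r p ∘ subst (_ ∈_) (sym eq) ∘ x∈p∪q⁺ ∘ inj₁))
leafSet-subtreeAt-injective f (node l r) (node _ _ disj) {inl p} {inr q} eq = ⊥-elim
  (overlap-⊥ disj (leafSet-nonempty (mapT f (subtreeAt l p)))
    (leafSet-subtreeAt-⊆ f l p) (leafSet-subtreeAt-⊆ f r q ∘ subst (_ ∈_) eq))
leafSet-subtreeAt-injective f (node l r) (node _ _ disj) {inr p} {inl q} eq = ⊥-elim
  (overlap-⊥ disj (leafSet-nonempty (mapT f (subtreeAt r p)))
    (leafSet-subtreeAt-⊆ f l q ∘ subst (_ ∈_) eq) (leafSet-subtreeAt-⊆ f r p))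

-- Restriction

nodeᴹ : Maybe (Tree A) → Maybe (Tree A) → Maybe (Tree A)
nodeᴹ (just l) (just r) = just (node l r)
nodeᴹ (just l) nothing  = just l
nodeᴹ nothing  (just r) = just r
nodeᴹ nothing  nothing  = nothing

restrict-node : (S : Subset n) (l r : Tree (Fin n)) →
                restrict S (node l r) ≡ nodeᴹ (restrict S l) (restrict S r)
restrict-node S l r with restrict S l | restrict S r
... | just _  | just _  = refl
... | just _  | nothing = refl
... | nothing | just _  = refl
... | nothing | nothing = refl

restrict-leaf-∈ : a ∈ S → restrict S (leaf a) ≡ just (leaf a)
restrict-leaf-∈ a∈S rewrite []=⇒lookup a∈S = refl

restrict-leaf-∉ : a ∉ S → restrict S (leaf a) ≡ nothing
restrict-leaf-∉ {a = a} {S = S} a∉S with lookup S a in eq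
... | true  = contradiction (lookup⇒[]= a S eq) a∉S
... | false = refl

restrict-leaf-just : (S : Subset n) → restrict S (leaf a) ≡ just t′ → t′ ≡ leaf a
restrict-leaf-just {a = a} S eq with a ∈? S
... | yes a∈S = sym (just-injective (trans (sym (restrict-leaf-∈ a∈S)) eq))
... | no  a∉S = contradiction (trans (sym (restrict-leaf-∉ a∉S)) eq) λ ()

leafSetᴹ : Maybe (Tree (Fin n)) → Subset n
leafSetᴹ (just t) = leafSet t
leafSetᴹ nothing  = ∅

leafSetᴹ-nodeᴹ : (x y : Maybe (Tree (Fin n))) → leafSetᴹ (nodeᴹ x y) ≡ leafSetᴹ x ∪ leafSetᴹ y
leafSetᴹ-nodeᴹ (just l) (just r) = refl
leafSetᴹ-nodeᴹ (just l) nothing  = sym (∪-identityʳ (leafSet l))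
leafSetᴹ-nodeᴹ nothing  (just r) = sym (∪-identityˡ (leafSet r))
leafSetᴹ-nodeᴹ nothing  nothing  = sym (∪-identityˡ ∅)

leafSetᴹ-restrict : (S : Subset n) (t : Tree (Fin n)) → leafSetᴹ (restrict S t) ≡ S ∩ leafSet t
leafSetᴹ-restrict S (leaf a) with a ∈? S
... | yes a∈S rewrite restrict-leaf-∈ a∈S = ⊆-antisym
  (λ b∈a → x∈p∩q⁺ (subst (_∈ S) (sym (x∈⁅y⁆⇒x≡y a b∈a)) a∈S , b∈a)) (p∩q⊆q S ⁅ a ⁆)
... | no  a∉S rewrite restrict-leaf-∉ a∉S = ⊆-antisym
  (λ b∈∅ → contradiction b∈∅ ∉⊥)
  (λ b∈S∩a → let b∈S , b∈a = x∈p∩q⁻ S ⁅ a ⁆ b∈S∩a in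
             contradiction (subst (_∈ S) (x∈⁅y⁆⇒x≡y a b∈a) b∈S) a∉S)
leafSetᴹ-restrict S (node l r) = begin
  leafSetᴹ (restrict S (node l r))                       ≡⟨ cong leafSetᴹ (restrict-node S l r) ⟩
  leafSetᴹ (nodeᴹ (restrict S l) (restrict S r))          ≡⟨ leafSetᴹ-nodeᴹ (restrict S l) (restrict S r) ⟩
  leafSetᴹ (restrict S l) ∪ leafSetᴹ (restrict S r)
    ≡⟨ cong₂ _∪_ (leafSetᴹ-restrict S l) (leafSetᴹ-restrict S r) ⟩
  (S ∩ leafSet l) ∪ (S ∩ leafSet r)                      ≡⟨ sym (∩-distribˡ-∪ S (leafSet l) (leafSet r)) ⟩
  S ∩ leafSet (node l r)                                 ∎
  where open ≡-Reasoning

leafSet-restrict : (S : Subset n) (t : Tree (Fin n)) → restrict S t ≡ just t′ → leafSet t′ ≡ S ∩ leafSet t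
leafSet-restrict S t eq = trans (cong leafSetᴹ (sym eq)) (leafSetᴹ-restrict S t)

∈-restrict⁻ : (S : Subset n) (t : Tree (Fin n)) → restrict S t ≡ just t′ → a ∈ leafSet t′ → a ∈ S × a ∈ leafSet t
∈-restrict⁻ S t eq a∈t′ = x∈p∩q⁻ S (leafSet t) (subst (_ ∈_) (leafSet-restrict S t eq) a∈t′)

∈-restrict⁺ : (S : Subset n) (t : Tree (Fin n)) → restrict S t ≡ just t′ → a ∈ S → a ∈ leafSet t → a ∈ leafSet t′
∈-restrict⁺ S t eq a∈S a∈t = subst (_ ∈_) (sym (leafSet-restrict S t eq)) (x∈p∩q⁺ (a∈S , a∈t))

restrict≡nothing⇒∉ : (S : Subset n) (t : Tree (Fin n)) → restrict S t ≡ nothing → a ∈ S → a ∉ leafSet t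
restrict≡nothing⇒∉ S t eq a∈S a∈t =
  ∉⊥ (subst (_ ∈_) (trans (sym (leafSetᴹ-restrict S t)) (cong leafSetᴹ eq)) (x∈p∩q⁺ (a∈S , a∈t)))

restrict≡nothing⇒Empty : X ⊆ S → (t : Tree (Fin n)) → restrict S t ≡ nothing → Empty (X ∩ leafSet t)
restrict≡nothing⇒Empty {X = X} {S = S} X⊆S t eq (a , a∈) =
  let a∈X , a∈t = x∈p∩q⁻ X (leafSet t) a∈ in restrict≡nothing⇒∉ S t eq (X⊆S a∈X) a∈t

restrict-just : (S : Subset n) (t : Tree (Fin n)) → a ∈ S → a ∈ leafSet t → ∃[ t′ ] restrict S t ≡ just t′
restrict-just S t a∈S a∈t with restrict S t in eq
... | just t′ = t′ , refl
... | nothing = contradiction a∈t (restrict≡nothing⇒∉ S t eq a∈S)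

∈-restrict⇔ : (S : Subset n) (t : Tree (Fin n)) → restrict S t ≡ just t′ → a ∈ S → (a ∈ leafSet t ⇔ a ∈ leafSet t′)
∈-restrict⇔ S t eq a∈S = mk⇔ (∈-restrict⁺ S t eq a∈S) (proj₂ ∘ ∈-restrict⁻ S t eq)

∩-restrict : X ⊆ S → (t : Tree (Fin n)) → restrict S t ≡ just t′ → X ∩ leafSet t ≡ X ∩ leafSet t′
∩-restrict {X = X} {S = S} {t′ = t′} X⊆S t eq = ⊆-antisym
  (λ a∈ → let a∈X , a∈t = x∈p∩q⁻ X (leafSet t) a∈ in x∈p∩q⁺ (a∈X , ∈-restrict⁺ S t eq (X⊆S a∈X) a∈t))
  (λ a∈ → let a∈X , a∈t′ = x∈p∩q⁻ X (leafSet t′) a∈ in x∈p∩q⁺ (a∈X , proj₂ (∈-restrict⁻ S t eq a∈t′)))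

restrict-⊇ : (t : Tree (Fin n)) → leafSet t ⊆ S → restrict S t ≡ just t
restrict-⊇ (leaf a)       t⊆S = restrict-leaf-∈ (t⊆S (x∈⁅x⁆ a))
restrict-⊇ {S = S} (node l r) t⊆S
  rewrite restrict-node S l r
        | restrict-⊇ l (t⊆S ∘ x∈p∪q⁺ ∘ inj₁)
        | restrict-⊇ r (t⊆S ∘ x∈p∪q⁺ ∘ inj₂) = refl

nodeᴹ-nothingʳ : (x : Maybe (Tree A)) → nodeᴹ x nothing ≡ x
nodeᴹ-nothingʳ (just _) = refl
nodeᴹ-nothingʳ nothing  = refl

nodeᴹ-nothingˡ : (x : Maybe (Tree A)) → nodeᴹ nothing x ≡ x
nodeᴹ-nothingˡ (just _) = refl
nodeᴹ-nothingˡ nothing  = refl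

nodeᴹ->>=-restrict : (Y : Subset n) (x y : Maybe (Tree (Fin n))) →
  (nodeᴹ x y >>= restrict Y) ≡ nodeᴹ (x >>= restrict Y) (y >>= restrict Y)
nodeᴹ->>=-restrict Y (just l) (just r) = restrict-node Y l r
nodeᴹ->>=-restrict Y (just l) nothing  = sym (nodeᴹ-nothingʳ (restrict Y l))
nodeᴹ->>=-restrict Y nothing  (just r) = sym (nodeᴹ-nothingˡ (restrict Y r))
nodeᴹ->>=-restrict Y nothing  nothing  = refl

restrict-restrict : Y ⊆ S → (t : Tree (Fin n)) → restrict Y t ≡ (restrict S t >>= restrict Y)
restrict-restrict {S = S} Y⊆S (leaf a) with a ∈? S
... | yes a∈S rewrite restrict-leaf-∈ a∈S = refl
... | no  a∉S rewrite restrict-leaf-∉ a∉S = restrict-leaf-∉ (a∉S ∘ Y⊆S)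
restrict-restrict {Y = Y} {S = S} Y⊆S (node l r) = begin
  restrict Y (node l r)
    ≡⟨ restrict-node Y l r ⟩
  nodeᴹ (restrict Y l) (restrict Y r)
    ≡⟨ cong₂ nodeᴹ (restrict-restrict Y⊆S l) (restrict-restrict Y⊆S r) ⟩
  nodeᴹ (restrict S l >>= restrict Y) (restrict S r >>= restrict Y)
    ≡⟨ sym (nodeᴹ->>=-restrict Y (restrict S l) (restrict S r)) ⟩
  (nodeᴹ (restrict S l) (restrict S r) >>= restrict Y)
    ≡⟨ cong (_>>= restrict Y) (sym (restrict-node S l r)) ⟩
  (restrict S (node l r) >>= restrict Y)
    ∎
  where open ≡-Reasoning

_≅ᴹ_ : Maybe (Tree A) → Maybe (Tree A) → Set
_≅ᴹ_ = Pointwise _≅_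

nodeᴹ-cong : {x x′ y y′ : Maybe (Tree A)} → x ≅ᴹ x′ → y ≅ᴹ y′ → nodeᴹ x y ≅ᴹ nodeᴹ x′ y′
nodeᴹ-cong (just p) (just q) = just (node≅ p q)
nodeᴹ-cong (just p) nothing  = just p
nodeᴹ-cong nothing  (just q) = just q
nodeᴹ-cong nothing  nothing  = nothing

nodeᴹ-comm : (x y : Maybe (Tree A)) → nodeᴹ x y ≅ᴹ nodeᴹ y x
nodeᴹ-comm (just l) (just r) = just (swap≅ (≅-refl l) (≅-refl r))
nodeᴹ-comm (just l) nothing  = just (≅-refl l)
nodeᴹ-comm nothing  (just r) = just (≅-refl r)
nodeᴹ-comm nothing  nothing  = nothing

restrict-≅ : (S : Subset n) {s t : Tree (Fin n)} → s ≅ t → restrict S s ≅ᴹ restrict S t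
restrict-≅ S (leaf≅ a) = Pointwise.refl (≅-refl _)
restrict-≅ S (node≅ {l} {r} {l′} {r′} p q)
  rewrite restrict-node S l r | restrict-node S l′ r′ = nodeᴹ-cong (restrict-≅ S p) (restrict-≅ S q)
restrict-≅ S (swap≅ {l} {r} {l′} {r′} p q)
  rewrite restrict-node S l r | restrict-node S l′ r′ =
  Pointwise.trans ≅-trans (nodeᴹ-cong (restrict-≅ S p) (restrict-≅ S q))
                          (nodeᴹ-comm (restrict S r′) (restrict S l′))

map-nodeᴹ : (f : A → B) (x y : Maybe (Tree A)) →
           Maybe.map (mapT f) (nodeᴹ x y) ≡ nodeᴹ (Maybe.map (mapT f) x) (Maybe.map (mapT f) y)
map-nodeᴹ f (just l) (just r) = refl
map-nodeᴹ f (just l) nothing  = refl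
map-nodeᴹ f nothing  (just r) = refl
map-nodeᴹ f nothing  nothing  = refl

restrict-mapT : {Y : Subset n} {Z : Subset k} (ψ : Fin k → Fin n) → (∀ {i} → ψ i ∈ Y ⇔ i ∈ Z) →
                (t : Tree (Fin k)) → restrict Y (mapT ψ t) ≡ Maybe.map (mapT ψ) (restrict Z t)
restrict-mapT {Z = Z} ψ ψ∈Y⇔∈Z (leaf i) with i ∈? Z
... | yes i∈Z rewrite restrict-leaf-∈ i∈Z = restrict-leaf-∈ (Equivalence.from ψ∈Y⇔∈Z i∈Z)
... | no  i∉Z rewrite restrict-leaf-∉ i∉Z = restrict-leaf-∉ (i∉Z ∘ Equivalence.to ψ∈Y⇔∈Z)
restrict-mapT {Y = Y} {Z = Z} ψ ψ∈Y⇔∈Z (node l r)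
  rewrite restrict-node Y (mapT ψ l) (mapT ψ r) | restrict-node Z l r
        | restrict-mapT ψ ψ∈Y⇔∈Z l | restrict-mapT ψ ψ∈Y⇔∈Z r =
  sym (map-nodeᴹ ψ (restrict Z l) (restrict Z r))

Distinct-restrict : (S : Subset n) (t : Tree (Fin n)) → Distinct t → restrict S t ≡ just t′ → Distinct t′
Distinct-restrict S (leaf a) _ eq rewrite restrict-leaf-just S eq = leaf
Distinct-restrict S (node l r) (node dl dr disj) eq
  rewrite restrict-node S l r with restrict S l in el | restrict S r in er | eq
... | just l′ | just r′ | refl =
  node (Distinct-restrict S l dl el) (Distinct-restrict S r dr er)
       (λ a∈l′ a∈r′ → disj (proj₂ (∈-restrict⁻ S l el a∈l′)) (proj₂ (∈-restrict⁻ S r er a∈r′)))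
... | just l′ | nothing | refl = Distinct-restrict S l dl el
... | nothing | just r′ | refl = Distinct-restrict S r dr er

-- Scars

whenNonempty : Subset n → Subset n → Maybe (Subset n)
whenNonempty D C = when (does (nonempty? D)) C

whenNonempty-nonempty : {D : Subset n} (C : Subset n) → Nonempty D → whenNonempty D C ≡ just C
whenNonempty-nonempty {D = D} C ne with nonempty? D
... | yes _ = refl
... | no ¬ne = contradiction ne ¬ne

whenNonempty-empty : {D : Subset n} (C : Subset n) → Empty D → whenNonempty D C ≡ nothing
whenNonempty-empty {D = D} C em with nonempty? D
... | yes ne = contradiction ne em
... | no _ = refl

scar-∉ : (S : Subset n) (t : Tree (Fin n)) → a ∉ leafSet t → scar S t a ≡ nothing
scar-∉ S (leaf b) _ = refl
scar-∉ {a = a} S (node l r) a∉t with a ∈? leafSet l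
... | yes a∈l = contradiction (x∈p∪q⁺ (inj₁ a∈l)) a∉t
... | no _ with a ∈? leafSet r
...   | yes a∈r = contradiction (x∈p∪q⁺ (inj₂ a∈r)) a∉t
...   | no _ = refl

scar-node-inl : (S : Subset n) (l r : Tree (Fin n)) → a ∈ leafSet l →
  scar S (node l r) a ≡ (scar S l a <∣> whenNonempty (S ∩ leafSet r) (S ∩ leafSet (node l r)))
scar-node-inl {a = a} S l r a∈l with a ∈? leafSet l
... | no a∉l = contradiction a∈l a∉l
... | yes _ with scar S l a
...   | just _ = refl
...   | nothing with nonempty? (S ∩ leafSet r)
...     | yes _ = refl
...     | no _ = refl

scar-node-inr : (S : Subset n) (l r : Tree (Fin n)) → a ∉ leafSet l → a ∈ leafSet r →
  scar S (node l r) a ≡ (scar S r a <∣> whenNonempty (S ∩ leafSet l) (S ∩ leafSet (node l r)))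
scar-node-inr {a = a} S l r a∉l a∈r with a ∈? leafSet l
... | yes a∈l = contradiction a∈l a∉l
... | no _ with a ∈? leafSet r
...   | no a∉r = contradiction a∈r a∉r
...   | yes _ with scar S r a
...     | just _ = refl
...     | nothing with nonempty? (S ∩ leafSet l)
...       | yes _ = refl
...       | no _ = refl

-- Splitting on 'toSum (a ∈? leafSet l)' rather than on 'a ∈? leafSet l' leaves the
-- occurrence of the latter inside 'scar' unabstracted, so that the equations above apply.
scar-node-emptyʳ : (S : Subset n) (l r : Tree (Fin n)) → a ∉ leafSet r → Empty (S ∩ leafSet r) →
                   scar S (node l r) a ≡ scar S l a
scar-node-emptyʳ {a = a} S l r a∉r em with toSum (a ∈? leafSet l)
... | inj₁ a∈l = trans (scar-node-inl S l r a∈l)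
  (trans (cong (scar S l a <∣>_) (whenNonempty-empty _ em)) (<∣>-identityʳ (scar S l a)))
... | inj₂ a∉l = trans (scar-∉ S (node l r) (∉-leafSet-node l r a∉l a∉r)) (sym (scar-∉ S l a∉l))

scar-node-emptyˡ : (S : Subset n) (l r : Tree (Fin n)) → a ∉ leafSet l → Empty (S ∩ leafSet l) →
                   scar S (node l r) a ≡ scar S r a
scar-node-emptyˡ {a = a} S l r a∉l em with toSum (a ∈? leafSet r)
... | inj₁ a∈r = trans (scar-node-inr S l r a∉l a∈r)
  (trans (cong (scar S r a <∣>_) (whenNonempty-empty _ em)) (<∣>-identityʳ (scar S r a)))
... | inj₂ a∉r = trans (scar-∉ S (node l r) (∉-leafSet-node l r a∉l a∉r)) (sym (scar-∉ S r a∉r))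

∩-leafSet-node-cong : (S : Subset n) (l r l′ r′ : Tree (Fin n)) →
  S ∩ leafSet l ≡ S ∩ leafSet l′ → S ∩ leafSet r ≡ S ∩ leafSet r′ →
  S ∩ leafSet (node l r) ≡ S ∩ leafSet (node l′ r′)
∩-leafSet-node-cong S l r l′ r′ Sl≡ Sr≡ = begin
  S ∩ (leafSet l ∪ leafSet r)             ≡⟨ ∩-distribˡ-∪ S (leafSet l) (leafSet r) ⟩
  (S ∩ leafSet l) ∪ (S ∩ leafSet r)       ≡⟨ cong₂ _∪_ Sl≡ Sr≡ ⟩
  (S ∩ leafSet l′) ∪ (S ∩ leafSet r′)     ≡⟨ sym (∩-distribˡ-∪ S (leafSet l′) (leafSet r′)) ⟩
  S ∩ (leafSet l′ ∪ leafSet r′)           ∎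
  where open ≡-Reasoning

scar-node-cong : (S : Subset n) {l r l′ r′ : Tree (Fin n)} →
  (a ∈ leafSet l ⇔ a ∈ leafSet l′) → (a ∈ leafSet r ⇔ a ∈ leafSet r′) →
  S ∩ leafSet l ≡ S ∩ leafSet l′ → S ∩ leafSet r ≡ S ∩ leafSet r′ →
  scar S l a ≡ scar S l′ a → scar S r a ≡ scar S r′ a →
  scar S (node l r) a ≡ scar S (node l′ r′) a
scar-node-cong {a = a} S {l} {r} {l′} {r′} ∈l⇔ ∈r⇔ Sl≡ Sr≡ scarˡ scarʳ
  with toSum (a ∈? leafSet l) | toSum (a ∈? leafSet r)
... | inj₁ a∈l | _ = begin
  scar S (node l r) a                                              ≡⟨ scar-node-inl S l r a∈l ⟩
  scar S l a <∣> whenNonempty (S ∩ leafSet r) (S ∩ leafSet (node l r))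
    ≡⟨ cong₂ _<∣>_ scarˡ (cong₂ whenNonempty Sr≡ (∩-leafSet-node-cong S l r l′ r′ Sl≡ Sr≡)) ⟩
  scar S l′ a <∣> whenNonempty (S ∩ leafSet r′) (S ∩ leafSet (node l′ r′))
    ≡⟨ sym (scar-node-inl S l′ r′ (Equivalence.to ∈l⇔ a∈l)) ⟩
  scar S (node l′ r′) a                                            ∎
  where open ≡-Reasoning
... | inj₂ a∉l | inj₁ a∈r = begin
  scar S (node l r) a                                              ≡⟨ scar-node-inr S l r a∉l a∈r ⟩
  scar S r a <∣> whenNonempty (S ∩ leafSet l) (S ∩ leafSet (node l r))
    ≡⟨ cong₂ _<∣>_ scarʳ (cong₂ whenNonempty Sl≡ (∩-leafSet-node-cong S l r l′ r′ Sl≡ Sr≡)) ⟩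
  scar S r′ a <∣> whenNonempty (S ∩ leafSet l′) (S ∩ leafSet (node l′ r′))
    ≡⟨ sym (scar-node-inr S l′ r′ (a∉l ∘ Equivalence.from ∈l⇔) (Equivalence.to ∈r⇔ a∈r)) ⟩
  scar S (node l′ r′) a                                            ∎
  where open ≡-Reasoning
... | inj₂ a∉l | inj₂ a∉r = trans (scar-∉ S (node l r) (∉-leafSet-node l r a∉l a∉r))
  (sym (scar-∉ S (node l′ r′) (∉-leafSet-node l′ r′ (a∉l ∘ Equivalence.from ∈l⇔) (a∉r ∘ Equivalence.from ∈r⇔))))

scar-restrict : X ⊆ S → m ∈ S → (t : Tree (Fin n)) → restrict S t ≡ just t′ → scar X t m ≡ scar X t′ m
scar-restrict {S = S} _ _ (leaf a) eq rewrite restrict-leaf-just S eq = refl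
scar-restrict {X = X} {S = S} X⊆S m∈S (node l r) eq
  rewrite restrict-node S l r with restrict S l in el | restrict S r in er | eq
... | just l′ | just r′ | refl =
  scar-node-cong X (∈-restrict⇔ S l el m∈S) (∈-restrict⇔ S r er m∈S)
    (∩-restrict X⊆S l el) (∩-restrict X⊆S r er) (scar-restrict X⊆S m∈S l el) (scar-restrict X⊆S m∈S r er)
... | just l′ | nothing | refl =
  trans (scar-node-emptyʳ X l r (restrict≡nothing⇒∉ S r er m∈S) (restrict≡nothing⇒Empty X⊆S r er))
        (scar-restrict X⊆S m∈S l el)
... | nothing | just r′ | refl =
  trans (scar-node-emptyˡ X l r (restrict≡nothing⇒∉ S l el m∈S) (restrict≡nothing⇒Empty X⊆S l el))
        (scar-restrict X⊆S m∈S r er)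

-- Grafting a leaf onto an edge

data Graft (m : A) : (s : Tree A) → Pos s → Tree A → Set where
  aboveʳ : ∀ {s} → Graft m s here (node s (leaf m))
  aboveˡ : ∀ {s} → Graft m s here (node (leaf m) s)
  inl    : ∀ {l r p l′} → Graft m l p l′ → Graft m (node l r) (inl p) (node l′ r)
  inr    : ∀ {l r p r′} → Graft m r p r′ → Graft m (node l r) (inr p) (node l r′)

∈-Graft : {s t : Tree (Fin n)} {p : Pos s} → Graft m s p t → m ∈ leafSet t
∈-Graft {m = m} aboveʳ = x∈p∪q⁺ (inj₂ (x∈⁅x⁆ m))
∈-Graft {m = m} aboveˡ = x∈p∪q⁺ (inj₁ (x∈⁅x⁆ m))
∈-Graft (inl g) = x∈p∪q⁺ (inj₁ (∈-Graft g))
∈-Graft (inr g) = x∈p∪q⁺ (inj₂ (∈-Graft g))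

∈-∪⁅⁆-∉ : a ∈ X ∪ ⁅ m ⁆ → a ∉ X → a ≡ m
∈-∪⁅⁆-∉ {X = X} {m = m} a∈ a∉X = [ (λ a∈X → contradiction a∈X a∉X) , x∈⁅y⁆⇒x≡y m ] (x∈p∪q⁻ X ⁅ m ⁆ a∈)

∈-∪⁅⁆-≢ : a ∈ X ∪ ⁅ m ⁆ → a ≢ m → a ∈ X
∈-∪⁅⁆-≢ {X = X} {m = m} a∈ a≢m = [ id , (λ a∈m → contradiction (x∈⁅y⁆⇒x≡y m a∈m) a≢m) ] (x∈p∪q⁻ X ⁅ m ⁆ a∈)

⊆-∪⁅⁆-∌ : {U : Subset n} → U ⊆ X ∪ ⁅ m ⁆ → m ∉ U → U ⊆ X
⊆-∪⁅⁆-∌ U⊆ m∉U a∈U = ∈-∪⁅⁆-≢ (U⊆ a∈U) λ { refl → m∉U a∈U }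

Graft-restrict : (t : Tree (Fin n)) → Distinct t → m ∈ leafSet t → m ∉ X → leafSet t ⊆ X ∪ ⁅ m ⁆ →
                 restrict X t ≡ just s → ∃[ p ] Graft m s p t
Graft-restrict {X = X} (leaf a) _ m∈t m∉X _ eq =
  contradiction (trans (sym (restrict-leaf-∉ (subst (_∉ X) (x∈⁅y⁆⇒x≡y a m∈t) m∉X))) eq) λ ()
Graft-restrict {X = X} (node l r) (node dl dr disj) m∈t m∉X t⊆ eq
  with x∈p∪q⁻ (leafSet l) (leafSet r) m∈t
... | inj₁ m∈l
  rewrite restrict-node X l r | restrict-⊇ r (⊆-∪⁅⁆-∌ (t⊆ ∘ x∈p∪q⁺ ∘ inj₂) (disj m∈l))
  with restrict X l in el | eq
...   | just l′ | refl = let p , g = Graft-restrict l dl m∈l m∉X (t⊆ ∘ x∈p∪q⁺ ∘ inj₁) el in inl p , inl g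
...   | nothing | refl rewrite Distinct⇒≡leaf dl (λ a∈l →
          ∈-∪⁅⁆-∉ (t⊆ (x∈p∪q⁺ (inj₁ a∈l))) (λ a∈X → restrict≡nothing⇒∉ X l el a∈X a∈l)) = here , aboveˡ
Graft-restrict {X = X} (node l r) (node dl dr disj) m∈t m∉X t⊆ eq
    | inj₂ m∈r
  rewrite restrict-node X l r | restrict-⊇ l (⊆-∪⁅⁆-∌ (t⊆ ∘ x∈p∪q⁺ ∘ inj₁) (λ m∈l → disj m∈l m∈r))
  with restrict X r in er | eq
...   | just r′ | refl = let p , g = Graft-restrict r dr m∈r m∉X (t⊆ ∘ x∈p∪q⁺ ∘ inj₂) er in inr p , inr g
...   | nothing | refl rewrite Distinct⇒≡leaf dr (λ a∈r →
          ∈-∪⁅⁆-∉ (t⊆ (x∈p∪q⁺ (inj₂ a∈r))) (λ a∈X → restrict≡nothing⇒∉ X r er a∈X a∈r)) = here , aboveʳ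

∩-∪⁅⁆ : {U : Subset n} → U ⊆ X → m ∉ X → X ∩ (U ∪ ⁅ m ⁆) ≡ U
∩-∪⁅⁆ {X = X} {m = m} {U} U⊆X m∉X = ⊆-antisym
  (λ a∈ → let a∈X , a∈U∪m = x∈p∩q⁻ X (U ∪ ⁅ m ⁆) a∈ in
          [ id , (λ a∈m → contradiction (subst (_∈ X) (x∈⁅y⁆⇒x≡y m a∈m) a∈X) m∉X) ] (x∈p∪q⁻ U ⁅ m ⁆ a∈U∪m))
  (λ a∈U → x∈p∩q⁺ (U⊆X a∈U , x∈p∪q⁺ (inj₁ a∈U)))

∩-leafSet-nonempty : (s : Tree (Fin n)) → leafSet s ⊆ X → Nonempty (X ∩ leafSet s)
∩-leafSet-nonempty s s⊆X = let a , a∈s = leafSet-nonempty s in a , x∈p∩q⁺ (s⊆X a∈s , a∈s)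

scar-Graft : {s t : Tree (Fin n)} {p : Pos s} → Graft m s p t → leafSet s ⊆ X → m ∉ X →
             scar X t m ≡ just (leafSet (subtreeAt s p))
scar-Graft {m = m} {X = X} {s = s} aboveʳ s⊆X m∉X = begin
  scar X (node s (leaf m)) m                                ≡⟨ scar-node-inr X s (leaf m) (m∉X ∘ s⊆X) (x∈⁅x⁆ m) ⟩
  whenNonempty (X ∩ leafSet s) (X ∩ (leafSet s ∪ ⁅ m ⁆))    ≡⟨ whenNonempty-nonempty _ (∩-leafSet-nonempty s s⊆X) ⟩
  just (X ∩ (leafSet s ∪ ⁅ m ⁆))                            ≡⟨ cong just (∩-∪⁅⁆ s⊆X m∉X) ⟩
  just (leafSet s)                                          ∎
  where open ≡-Reasoning
scar-Graft {m = m} {X = X} {s = s} aboveˡ s⊆X m∉X = begin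
  scar X (node (leaf m) s) m                                ≡⟨ scar-node-inl X (leaf m) s (x∈⁅x⁆ m) ⟩
  whenNonempty (X ∩ leafSet s) (X ∩ (⁅ m ⁆ ∪ leafSet s))    ≡⟨ whenNonempty-nonempty _ (∩-leafSet-nonempty s s⊆X) ⟩
  just (X ∩ (⁅ m ⁆ ∪ leafSet s))                            ≡⟨ cong (just ∘ (X ∩_)) (∪-comm ⁅ m ⁆ (leafSet s)) ⟩
  just (X ∩ (leafSet s ∪ ⁅ m ⁆))                            ≡⟨ cong just (∩-∪⁅⁆ s⊆X m∉X) ⟩
  just (leafSet s)                                          ∎
  where open ≡-Reasoning
scar-Graft {X = X} (inl {l} {r} {l′ = l′} g) s⊆X m∉X =
  trans (scar-node-inl X l′ r (∈-Graft g)) (cong (_<∣> _) (scar-Graft g (s⊆X ∘ x∈p∪q⁺ ∘ inj₁) m∉X))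
scar-Graft {X = X} (inr {l} {r} {r′ = r′} g) s⊆X m∉X =
  trans (scar-node-inr X l r′ (m∉X ∘ s⊆X ∘ x∈p∪q⁺ ∘ inj₁) (∈-Graft g))
        (cong (_<∣> _) (scar-Graft g (s⊆X ∘ x∈p∪q⁺ ∘ inj₂) m∉X))

Graft-≅ : {s s′ t : Tree (Fin n)} {p : Pos s} → Graft m s p t → s ≅ s′ →
  ∃[ p′ ] ∃[ t′ ] Graft m s′ p′ t′ × t ≅ t′ × leafSet (subtreeAt s p) ≡ leafSet (subtreeAt s′ p′)
Graft-≅ {m = m} aboveʳ s≅s′ = here , _ , aboveʳ , node≅ s≅s′ (leaf≅ m) , leafSet-≅ s≅s′
Graft-≅ {m = m} aboveˡ s≅s′ = here , _ , aboveˡ , node≅ (leaf≅ m) s≅s′ , leafSet-≅ s≅s′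
Graft-≅ (inl g) (node≅ l≅l′ r≅r′) =
  let p′ , _ , g′ , t≅t′ , eq = Graft-≅ g l≅l′ in inl p′ , _ , inl g′ , node≅ t≅t′ r≅r′ , eq
Graft-≅ (inl g) (swap≅ l≅r′ r≅l′) =
  let p′ , _ , g′ , t≅t′ , eq = Graft-≅ g l≅r′ in inr p′ , _ , inr g′ , swap≅ t≅t′ r≅l′ , eq
Graft-≅ (inr g) (node≅ l≅l′ r≅r′) =
  let p′ , _ , g′ , t≅t′ , eq = Graft-≅ g r≅r′ in inr p′ , _ , inr g′ , node≅ l≅l′ t≅t′ , eq
Graft-≅ (inr g) (swap≅ l≅r′ r≅l′) =
  let p′ , _ , g′ , t≅t′ , eq = Graft-≅ g r≅l′ in inl p′ , _ , inl g′ , swap≅ l≅r′ t≅t′ , eq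

graftFresh : (K : Tree (Fin k)) → Pos K → Tree (Fin (ℕ.suc k))
graftFresh K          here    = node (mapT suc K) (leaf zero)
graftFresh (node l r) (inl p) = node (graftFresh l p) (mapT suc r)
graftFresh (node l r) (inr p) = node (mapT suc l) (graftFresh r p)

mapT-∷-suc : (m : Fin n) (φ : Fin k → Fin n) (K : Tree (Fin k)) → mapT φ K ≅ mapT (m ∷ᶠ φ) (mapT suc K)
mapT-∷-suc m φ K = ≅-reflexive (mapT-∘ (m ∷ᶠ φ) suc K)

Graft-mapT : (φ : Fin k → Fin n) (K : Tree (Fin k)) {p : Pos (mapT φ K)} {t : Tree (Fin n)} →
  Graft m (mapT φ K) p t →
  ∃[ q ] t ≅ mapT (m ∷ᶠ φ) (graftFresh K q) × leafSet (subtreeAt (mapT φ K) p) ≡ leafSet (mapT φ (subtreeAt K q))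
Graft-mapT {m = m} φ K@(leaf _)   aboveʳ  = here , node≅ (mapT-∷-suc m φ K) (leaf≅ m) , refl
Graft-mapT {m = m} φ K@(leaf _)   aboveˡ  = here , swap≅ (leaf≅ m) (mapT-∷-suc m φ K) , refl
Graft-mapT {m = m} φ K@(node _ _) aboveʳ  = here , node≅ (mapT-∷-suc m φ K) (leaf≅ m) , refl
Graft-mapT {m = m} φ K@(node _ _) aboveˡ  = here , swap≅ (leaf≅ m) (mapT-∷-suc m φ K) , refl
Graft-mapT {m = m} φ (node l r)   (inl g) =
  let q , t≅ , eq = Graft-mapT φ l g in inl q , node≅ t≅ (mapT-∷-suc m φ r) , eq
Graft-mapT {m = m} φ (node l r)   (inr g) =
  let q , t≅ , eq = Graft-mapT φ r g in inr q , node≅ (mapT-∷-suc m φ l) t≅ , eq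

RestrictsTo : Subset n → Tree (Fin n) → (Fin k → Fin n) → Tree (Fin k) → Set
RestrictsTo {n} Y t ι K = Σ (Tree (Fin n)) λ t′ → restrict Y t ≡ just t′ × mapT ι K ≅ t′

graftAtScar : {X : Subset n} {φ : Fin k → Fin n} {K : Tree (Fin k)} (t : Tree (Fin n)) →
  Distinct t → m ∈ leafSet t → m ∉ X → RestrictsTo X t φ K →
  ∃[ q ] RestrictsTo (X ∪ ⁅ m ⁆) t (m ∷ᶠ φ) (graftFresh K q)
       × scar X t m ≡ just (leafSet (mapT φ (subtreeAt K q)))
graftAtScar {m = m} {X = X} {φ} {K} t dt m∈t m∉X (s , eqˢ , K≅s) =
  let tₘ , eqₘ = restrict-just Xm t m∈Xm m∈t
      eqˢₘ : restrict X tₘ ≡ just s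
      eqˢₘ = trans (sym (trans (restrict-restrict X⊆Xm t) (cong (_>>= restrict X) eqₘ))) eqˢ
      p , graft = Graft-restrict tₘ (Distinct-restrict Xm t dt eqₘ) (∈-restrict⁺ Xm t eqₘ m∈Xm m∈t)
                                 m∉X (proj₁ ∘ ∈-restrict⁻ Xm t eqₘ) eqˢₘ
      _ , _ , graft′ , tₘ≅t′ , edge≡ = Graft-≅ graft (≅-sym K≅s)
      q , t′≅ , edge≡′ = Graft-mapT φ K graft′
      s⊆X : leafSet s ⊆ X
      s⊆X = p∩q⊆p X (leafSet t) ∘ subst (_ ∈_) (leafSet-restrict X t eqˢ)
  in q , (tₘ , eqₘ , ≅-sym (≅-trans tₘ≅t′ t′≅)) , (begin
    scar X t m                                 ≡⟨ scar-restrict X⊆Xm m∈Xm t eqₘ ⟩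
    scar X tₘ m                                ≡⟨ scar-Graft graft s⊆X m∉X ⟩
    just (leafSet (subtreeAt s p))             ≡⟨ cong just (trans edge≡ edge≡′) ⟩
    just (leafSet (mapT φ (subtreeAt K q)))    ∎)
  where
  open ≡-Reasoning
  Xm = X ∪ ⁅ m ⁆
  X⊆Xm : X ⊆ Xm
  X⊆Xm = x∈p∪q⁺ ∘ inj₁
  m∈Xm : m ∈ Xm
  m∈Xm = x∈p∪q⁺ (inj₂ (x∈⁅x⁆ m))

image : (Fin k → Fin n) → Subset n
image {k = ℕ.zero}  f = ∅
image {k = ℕ.suc k} f = ⁅ f zero ⁆ ∪ image (f ∘ suc)

∈-image⁺ : (f : Fin k → Fin n) (i : Fin k) → f i ∈ image f
∈-image⁺ f zero    = x∈p∪q⁺ (inj₁ (x∈⁅x⁆ (f zero)))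
∈-image⁺ f (suc i) = x∈p∪q⁺ (inj₂ (∈-image⁺ (f ∘ suc) i))

∈-image⁻ : (f : Fin k → Fin n) → a ∈ image f → ∃[ i ] f i ≡ a
∈-image⁻ {k = ℕ.zero}  f a∈ = contradiction a∈ ∉⊥
∈-image⁻ {k = ℕ.suc k} f a∈ with x∈p∪q⁻ ⁅ f zero ⁆ (image (f ∘ suc)) a∈
... | inj₁ a∈f0 = zero , sym (x∈⁅y⁆⇒x≡y (f zero) a∈f0)
... | inj₂ a∈fs = let i , eq = ∈-image⁻ (f ∘ suc) a∈fs in suc i , eq

∈-image-∘ : {d : ℕ} (ψ : Fin k → Fin n) (ι : Fin d → Fin k) → (∀ {i j} → ψ i ≡ ψ j → i ≡ j) →
            ∀ {i} → ψ i ∈ image (ψ ∘ ι) ⇔ i ∈ image ι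
∈-image-∘ ψ ι ψ-inj = mk⇔
  (λ ψi∈ → let j , eq = ∈-image⁻ (ψ ∘ ι) ψi∈ in subst (_∈ image ι) (ψ-inj eq) (∈-image⁺ ι j))
  (λ i∈ → let j , eq = ∈-image⁻ ι i∈ in subst (_∈ image (ψ ∘ ι)) (cong ψ eq) (∈-image⁺ (ψ ∘ ι) j))

RestrictsTo-lift : {d : ℕ} {S : Subset n} {t : Tree (Fin n)} {ψ : Fin k → Fin n} {G : Tree (Fin k)}
  {ι : Fin d → Fin k} {K : Tree (Fin d)} →
  (∀ {i j} → ψ i ≡ ψ j → i ≡ j) → image (ψ ∘ ι) ⊆ S →
  RestrictsTo S t ψ G → RestrictsTo (image ι) G ι K → RestrictsTo (image (ψ ∘ ι)) t (ψ ∘ ι) K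
RestrictsTo-lift {t = t} {ψ} {G} {ι} {K} ψ-inj Y⊆S (tₛ , eqₛ , G≅tₛ) (A , eqᴬ , K≅A) =
  let restrict-G : restrict (image (ψ ∘ ι)) (mapT ψ G) ≡ just (mapT ψ A)
      restrict-G = trans (restrict-mapT ψ (∈-image-∘ ψ ι ψ-inj) G) (cong (Maybe.map (mapT ψ)) eqᴬ)
      t′ , eq′ , A≅t′ = just-inv (subst (_≅ᴹ _) restrict-G (restrict-≅ (image (ψ ∘ ι)) G≅tₛ))
  in t′ , trans (restrict-restrict Y⊆S t) (trans (cong (_>>= restrict _) eqₛ) eq′) ,
     ≅-trans (≅-reflexive (mapT-∘ ψ ι K)) (≅-trans (mapT-≅ ψ K≅A) A≅t′)

CrossVia : Tree (Fin n) → Tree (Fin n) → (Fin 4 → Fin n) → Set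
CrossVia tL tR ι = (RestrictsTo (image ι) tL ι K1L × RestrictsTo (image ι) tR ι K1R)
                 ⊎ (RestrictsTo (image ι) tL ι K2L × RestrictsTo (image ι) tR ι K2R)

CrossVia-lift : {S : Subset n} {tL tR : Tree (Fin n)} {ψ : Fin k → Fin n} {GL GR : Tree (Fin k)}
  {ι : Fin 4 → Fin k} → (∀ {i j} → ψ i ≡ ψ j → i ≡ j) → image (ψ ∘ ι) ⊆ S →
  RestrictsTo S tL ψ GL → RestrictsTo S tR ψ GR → CrossVia GL GR ι → CrossVia tL tR (ψ ∘ ι)
CrossVia-lift {tL = tL} {tR} {ψ} {GL} {GR} {ι} ψ-inj Y⊆S restrictsᴸ restrictsᴿ = Sum.map lift lift
  where
  lift : ∀ {KL KR} → RestrictsTo (image ι) GL ι KL × RestrictsTo (image ι) GR ι KR →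
         RestrictsTo (image (ψ ∘ ι)) tL (ψ ∘ ι) KL × RestrictsTo (image (ψ ∘ ι)) tR (ψ ∘ ι) KR
  lift = Product.map (RestrictsTo-lift {t = tL} ψ-inj Y⊆S restrictsᴸ)
                     (RestrictsTo-lift {t = tR} ψ-inj Y⊆S restrictsᴿ)

CrossVia⇒CrossResponsible : (T : Tanglegram n) {ι : Fin 4 → Fin n} → CrossVia (L T) (R T) ι →
                            CrossResponsible T (image ι)
CrossVia⇒CrossResponsible T {ι} = Sum.map (ι ,_) (ι ,_)

-- K2 with one more leaf

pattern pos-a = here
pattern pos-b = inr here
pattern pos-c = inl here
pattern pos-d = inr (inl here)
pattern pos-e = inr (inr here)
pattern pos-f = inr (inr (inl here))
pattern pos-g = inr (inr (inr here))

data AllowedScarType : Pos K2L → Pos K2R → Set where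
  a₁a₂ : AllowedScarType pos-a pos-a
  a₁b₂ : AllowedScarType pos-a pos-b
  b₁a₂ : AllowedScarType pos-b pos-a
  a₁c₂ : AllowedScarType pos-a pos-c
  c₁a₂ : AllowedScarType pos-c pos-a
  b₁c₂ : AllowedScarType pos-b pos-c
  c₁b₂ : AllowedScarType pos-c pos-b
  d₁f₂ : AllowedScarType pos-d pos-f
  f₁d₂ : AllowedScarType pos-f pos-d

allowed? : ∀ p q → Maybe (AllowedScarType p q)
allowed? pos-a pos-a = just a₁a₂
allowed? pos-a pos-b = just a₁b₂
allowed? pos-b pos-a = just b₁a₂
allowed? pos-a pos-c = just a₁c₂
allowed? pos-c pos-a = just c₁a₂
allowed? pos-b pos-c = just b₁c₂
allowed? pos-c pos-b = just c₁b₂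
allowed? pos-d pos-f = just d₁f₂
allowed? pos-f pos-d = just f₁d₂
allowed? _     _     = nothing

_≅?_ : (s t : Tree (Fin n)) → Maybe (s ≅ t)
leaf a   ≅? leaf b with a ≟ b
... | yes refl = just (leaf≅ a)
... | no _     = nothing
node l r ≅? node l′ r′ =
  Maybe.zipWith node≅ (l ≅? l′) (r ≅? r′) <∣> Maybe.zipWith swap≅ (l ≅? r′) (r ≅? l′)
leaf _   ≅? node _ _ = nothing
node _ _ ≅? leaf _   = nothing

restrictsTo? : (Y : Subset n) (t : Tree (Fin n)) (ι : Fin k → Fin n) (K : Tree (Fin k)) →
               Maybe (RestrictsTo Y t ι K)
restrictsTo? Y t ι K with restrict Y t
... | nothing = nothing
... | just t′ = Maybe.map (λ K≅t′ → t′ , refl , K≅t′) (mapT ι K ≅? t′)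

crossVia? : (tL tR : Tree (Fin n)) (ι : Fin 4 → Fin n) → Maybe (CrossVia tL tR ι)
crossVia? tL tR ι =
  Maybe.map inj₁ (Maybe.zipWith _,_ (restrictsTo? (image ι) tL ι K1L) (restrictsTo? (image ι) tR ι K1R)) <∣>
  Maybe.map inj₂ (Maybe.zipWith _,_ (restrictsTo? (image ι) tL ι K2L) (restrictsTo? (image ι) tR ι K2R))

allMaps : (k : ℕ) → List (Fin k → Fin n)
allMaps ℕ.zero    = (λ ()) ∷ []
allMaps (ℕ.suc k) = concatMap (λ a → List.map (a ∷ᶠ_) (allMaps k)) (allFin _)

firstJust : {P : A → Set} → ((a : A) → Maybe (P a)) → List A → Maybe (Σ A P)
firstJust f []       = nothing
firstJust f (a ∷ as) = Maybe.map (a ,_) (f a) <∣> firstJust f as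

forallPos : {t : Tree A} {P : Pos t → Set} → ((p : Pos t) → Maybe (P p)) → Maybe ((p : Pos t) → P p)
forallPos {t = leaf _} f = Maybe.map (λ h → λ { here → h }) (f here)
forallPos {t = node l r} {P} f =
  f here >>= λ h →
  forallPos {P = P ∘ inl} (f ∘ inl) >>= λ hˡ →
  forallPos {P = P ∘ inr} (f ∘ inr) >>= λ hʳ →
  just λ { here → h ; (inl p) → hˡ p ; (inr p) → hʳ p }

FreshCross : Tree (Fin 5) → Tree (Fin 5) → Set
FreshCross tL tR = ∃[ ι ] zero ∈ image ι × CrossVia tL tR ι

freshCross? : (tL tR : Tree (Fin 5)) → Maybe (FreshCross tL tR)
freshCross? tL tR =
  firstJust (λ ι → Maybe.zipWith _,_ (dec⇒maybe (zero ∈? image ι)) (crossVia? tL tR ι)) (allMaps 4)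

-- The case analysis of the lemma, by exhaustive search over the 49 pairs of edges and all maps
-- Fin 4 → Fin 5; opaque, because unfolding it at symbolic edges would rerun the search.
opaque
  K2-graft-cases : ∀ p q → AllowedScarType p q ⊎ FreshCross (graftFresh K2L p) (graftFresh K2R q)
  K2-graft-cases = from-just (forallPos λ p → forallPos λ q →
    Maybe.map inj₁ (allowed? p q) <∣> Maybe.map inj₂ (freshCross? (graftFresh K2L p) (graftFresh K2R q)))

∈-K2 : (side : Side) (i : Fin 4) → i ∈ leafSet (K2side side)
∈-K2 left  i = ∈⊤
∈-K2 right i = ∈⊤

module UniqueK2 {n : ℕ} (T : Tanglegram n) (X : Subset n) (unique : ∀ Y → CrossResponsible T Y → Y ≡ X)
                (φ : Fin 4 → Fin n) (iso : IsoVia T X φ K2L K2R) where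

  restrictsTo-K2 : (side : Side) → RestrictsTo X (treeOf T side) φ (K2side side)
  restrictsTo-K2 left  = proj₁ iso
  restrictsTo-K2 right = proj₂ iso

  Distinct-tree : (side : Side) → Distinct (treeOf T side)
  Distinct-tree left  = Unique⇒Distinct (L T) (L-unique T)
  Distinct-tree right = Unique⇒Distinct (R T) (R-unique T)

  ∈-tree : (side : Side) (a : Fin n) → a ∈ leafSet (treeOf T side)
  ∈-tree left  a = ∈-leaves⇒∈-leafSet (L T) (L-all T a)
  ∈-tree right a = ∈-leaves⇒∈-leafSet (R T) (R-all T a)

  Distinct-K2 : (side : Side) → Distinct (mapT φ (K2side side))
  Distinct-K2 side = let _ , eq , K≅s = restrictsTo-K2 side in
    Distinct-≅ (≅-sym K≅s) (Distinct-restrict X (treeOf T side) (Distinct-tree side) eq)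

  φ∈X : (i : Fin 4) → φ i ∈ X
  φ∈X i = let _ , eq , K≅s = restrictsTo-K2 left in
    p∩q⊆p X (leafSet (L T)) (subst (_ ∈_) (trans (leafSet-≅ K≅s) (leafSet-restrict X (L T) eq))
                                       (∈-leafSet-mapT φ K2L (∈-K2 left i)))

  φ-injective : ∀ {i j} → φ i ≡ φ j → i ≡ j
  φ-injective {i} {j} = Distinct-mapT-injective φ K2L (Distinct-K2 left) (∈-K2 left i) (∈-K2 left j)

  scar-position-unique : (side : Side) {p p′ : Pos (K2side side)} {m : Fin n} →
    HasScarOn T X m (K2edge φ side p) → HasScarOn T X m (K2edge φ side p′) → p ≡ p′
  scar-position-unique side scar≡ scar≡′ =
    leafSet-subtreeAt-injective φ (K2side side) (Distinct-K2 side) (just-injective (trans (sym scar≡) scar≡′))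

  module _ {m : Fin n} (m∉X : m ∉ X) where

    ψ : Fin 5 → Fin n
    ψ = m ∷ᶠ φ

    ψ-injective : ∀ {i j} → ψ i ≡ ψ j → i ≡ j
    ψ-injective {zero}  {zero}  _  = refl
    ψ-injective {zero}  {suc j} eq = contradiction (subst (_∈ X) (sym eq) (φ∈X j)) m∉X
    ψ-injective {suc i} {zero}  eq = contradiction (subst (_∈ X) eq (φ∈X i)) m∉X
    ψ-injective {suc i} {suc j} eq = cong suc (φ-injective eq)

    image-ψ-⊆ : (ι : Fin 4 → Fin 5) → image (ψ ∘ ι) ⊆ X ∪ ⁅ m ⁆
    image-ψ-⊆ ι a∈ with ∈-image⁻ (ψ ∘ ι) a∈
    ... | i , refl with ι i
    ...   | zero  = x∈p∪q⁺ (inj₂ (x∈⁅x⁆ m))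
    ...   | suc j = x∈p∪q⁺ (inj₁ (φ∈X j))

    allowedScarType : ∃[ p ] ∃[ q ] AllowedScarType p q × ScarType T X m (K2edge φ left p) (K2edge φ right q)
    allowedScarType =
      let p , restrictsᴸ , scarᴸ = graftAtScar (L T) (Distinct-tree left) (∈-tree left m) m∉X (restrictsTo-K2 left)
          q , restrictsᴿ , scarᴿ = graftAtScar (R T) (Distinct-tree right) (∈-tree right m) m∉X (restrictsTo-K2 right)
          fresh-leaf-in-X : FreshCross (graftFresh K2L p) (graftFresh K2R q) → m ∈ X
          fresh-leaf-in-X (ι , zero∈ι , cross) =
            let i , ιi≡0 = ∈-image⁻ ι zero∈ι
                m∈image = subst (_∈ image (ψ ∘ ι)) (cong ψ ιi≡0) (∈-image⁺ (ψ ∘ ι) i)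
                cross′ : CrossVia (L T) (R T) (ψ ∘ ι)
                cross′ = CrossVia-lift {tL = L T} {R T} {ι = ι} ψ-injective (image-ψ-⊆ ι)
                                       restrictsᴸ restrictsᴿ cross
            in subst (m ∈_) (unique (image (ψ ∘ ι)) (CrossVia⇒CrossResponsible T {ψ ∘ ι} cross′)) m∈image
      in [ (λ allowed → p , q , allowed , scarᴸ , scarᴿ) , (λ fresh → contradiction (fresh-leaf-in-X fresh) m∉X) ]′
           (K2-graft-cases p q)

  open Labels φ

  HasListedScarType : Fin n → Set
  HasListedScarType m =
      ScarType T X m a₁ a₂ ⊎ ScarType T X m a₁ b₂ ⊎ ScarType T X m b₁ a₂
    ⊎ ScarType T X m a₁ c₂ ⊎ ScarType T X m c₁ a₂ ⊎ ScarType T X m b₁ c₂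
    ⊎ ScarType T X m c₁ b₂ ⊎ ScarType T X m d₁ f₂ ⊎ ScarType T X m f₁ d₂

  listedScarType : {m : Fin n} → m ∉ X → HasListedScarType m
  listedScarType m∉X = let _ , _ , allowed , scars = allowedScarType m∉X in listed allowed scars
    where
    listed : ∀ {m p q} → AllowedScarType p q →
             ScarType T X m (K2edge φ left p) (K2edge φ right q) → HasListedScarType m
    listed a₁a₂ = inj₁
    listed a₁b₂ = inj₂ ∘ inj₁
    listed b₁a₂ = inj₂ ∘ inj₂ ∘ inj₁
    listed a₁c₂ = inj₂ ∘ inj₂ ∘ inj₂ ∘ inj₁
    listed c₁a₂ = inj₂ ∘ inj₂ ∘ inj₂ ∘ inj₂ ∘ inj₁
    listed b₁c₂ = inj₂ ∘ inj₂ ∘ inj₂ ∘ inj₂ ∘ inj₂ ∘ inj₁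
    listed c₁b₂ = inj₂ ∘ inj₂ ∘ inj₂ ∘ inj₂ ∘ inj₂ ∘ inj₂ ∘ inj₁
    listed d₁f₂ = inj₂ ∘ inj₂ ∘ inj₂ ∘ inj₂ ∘ inj₂ ∘ inj₂ ∘ inj₂ ∘ inj₁
    listed f₁d₂ = inj₂ ∘ inj₂ ∘ inj₂ ∘ inj₂ ∘ inj₂ ∘ inj₂ ∘ inj₂ ∘ inj₂

  unscarredˡ : (p₀ : Pos K2L) → (∀ {q} → ¬ AllowedScarType p₀ q) → ¬ CarriesScar T X (K2edge φ left p₀)
  unscarredˡ p₀ none (m , m∉X , scar≡) =
    let p , q , allowed , scarᴸ , _ = allowedScarType m∉X in
    none (subst (λ p → AllowedScarType p q) (scar-position-unique left scarᴸ scar≡) allowed)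

  unscarredʳ : (q₀ : Pos K2R) → (∀ {p} → ¬ AllowedScarType p q₀) → ¬ CarriesScar T X (K2edge φ right q₀)
  unscarredʳ q₀ none (m , m∉X , scar≡) =
    let p , q , allowed , _ , scarᴿ = allowedScarType m∉X in
    none (subst (AllowedScarType p) (scar-position-unique right scarᴿ scar≡) allowed)

  partnerʳ : (p₀ : Pos K2L) (q₀ : Pos K2R) → (∀ {q} → AllowedScarType p₀ q → q ≡ q₀) → {m : Fin n} → m ∉ X →
             HasScarOn T X m (K2edge φ left p₀) → HasScarOn T X m (K2edge φ right q₀)
  partnerʳ p₀ q₀ forced {m} m∉X scar≡ =
    let p , q , allowed , scarᴸ , scarᴿ = allowedScarType m∉X in
    subst (λ q → HasScarOn T X m (K2edge φ right q))
          (forced (subst (λ p → AllowedScarType p q) (scar-position-unique left scarᴸ scar≡) allowed)) scarᴿ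

  partnerˡ : (p₀ : Pos K2L) (q₀ : Pos K2R) → (∀ {p} → AllowedScarType p q₀ → p ≡ p₀) → {m : Fin n} → m ∉ X →
             HasScarOn T X m (K2edge φ right q₀) → HasScarOn T X m (K2edge φ left p₀)
  partnerˡ p₀ q₀ forced {m} m∉X scar≡ =
    let p , q , allowed , scarᴸ , scarᴿ = allowedScarType m∉X in
    subst (λ p → HasScarOn T X m (K2edge φ left p))
          (forced (subst (AllowedScarType p) (scar-position-unique right scarᴿ scar≡) allowed)) scarᴸ

lemma7 : {n : ℕ} (T : Tanglegram n) (X : Subset n) →
    CrossResponsible T X →
    (∀ (Y : Subset n) → CrossResponsible T Y → Y ≡ X) →
    (φ : Fin 4 → Fin n) → IsoVia T X φ K2L K2R →
    let open Labels φ in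
    (∀ (m : Fin n) → m ∉ X →
        ScarType T X m a₁ a₂ ⊎ ScarType T X m a₁ b₂ ⊎ ScarType T X m b₁ a₂
      ⊎ ScarType T X m a₁ c₂ ⊎ ScarType T X m c₁ a₂ ⊎ ScarType T X m b₁ c₂
      ⊎ ScarType T X m c₁ b₂ ⊎ ScarType T X m d₁ f₂ ⊎ ScarType T X m f₁ d₂)
    × (¬ CarriesScar T X e₁ × ¬ CarriesScar T X e₂
       × ¬ CarriesScar T X g₁ × ¬ CarriesScar T X g₂)
    × (∀ (m : Fin n) → m ∉ X →
        (HasScarOn T X m d₁ ⇔ HasScarOn T X m f₂)
      × (HasScarOn T X m d₂ ⇔ HasScarOn T X m f₁))
lemma7 T X _ unique φ iso =
    (λ _ → listedScarType)
  , (unscarredˡ pos-e (λ ()) , unscarredʳ pos-e (λ ()) , unscarredˡ pos-g (λ ()) , unscarredʳ pos-g (λ ()))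
  , λ _ m∉X →
      mk⇔ (partnerʳ pos-d pos-f (λ { d₁f₂ → refl }) m∉X) (partnerˡ pos-d pos-f (λ { d₁f₂ → refl }) m∉X)
    , mk⇔ (partnerˡ pos-f pos-d (λ { f₁d₂ → refl }) m∉X) (partnerʳ pos-f pos-d (λ { f₁d₂ → refl }) m∉X)
  where open UniqueK2 T X unique φ iso
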